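{- For every positive integer $n$ and every even integer $k\ge2$, $D'_{k,\frac{k^2}{4}n,\,n}=(C_{k/2,n})^2$.
   Context: For $j\ge1$, a $j$-dimensional balanced ballot path of length $jn$ is a sequence of $jn$ standard unit vectors of $\mathbb{R}^j$, each $\vec e_i$ occurring exactly $n$ times, such that every intermediate point (partial sum) $\vec x=(x_1,\dots,x_j)$ satisfies $x_1\ge\cdots\ge x_j$; $C_{j,n}$ denotes the number of such paths. The semisymmetric height of $\vec x\in\mathbb{Z}^k_{\ge0}$ is $g_k(\vec x)=\sum_{i=1}^k(k+1-2i)x_i$, and the semisymmetric height of a path is the maximum of $g_k$ over its intermediate points. $D'_{k,u,n}$ denotes the number of $k$-dimensional balanced ballot paths of length $kn$ whose semisymmetric height is exactly $u$. -}

module Defs where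

open import Data.Nat as ℕ using (ℕ; zero; suc; _*_; _≤ᵇ_)
open import Data.Integer as ℤ using (ℤ; +_; _-_; _⊔_)
open import Data.Fin using (Fin; toℕ)
open import Data.Fin.Properties using (_≟_)
open import Data.Bool using (Bool; true; false; _∧_; if_then_else_)
open import Data.List using (List; []; _∷_; map; concatMap; allFin; inits; foldr; length)
open import Relation.Nullary.Decidable using (⌊_⌋)

-- All words (sequences of standard unit vectors e_i, coded by i : Fin j)
-- of length m.
words : (j m : ℕ) → List (List (Fin j))
words j zero    = [] ∷ []
words j (suc m) = concatMap (λ w → map (_∷ w) (allFin j)) (words j m)

allB : {A : Set} → (A → Bool) → List A → Bool
allB p []       = true
allB p (x ∷ xs) = p x ∧ allB p xs

countB : {A : Set} → (A → Bool) → List A → ℕ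
countB p []       = zero
countB p (x ∷ xs) = if p x then suc (countB p xs) else countB p xs

occ : {j : ℕ} → Fin j → List (Fin j) → ℕ
occ i = countB (λ a → ⌊ a ≟ i ⌋)

-- The point (partial sum) reached by a word: x_i = number of steps e_i.
point : {j : ℕ} → List (Fin j) → Fin j → ℕ
point w i = occ i w

weaklyDecreasing : {j : ℕ} → (Fin j → ℕ) → Bool
weaklyDecreasing {j} x =
  allB (λ a → allB (λ b → if toℕ a ≤ᵇ toℕ b then x b ≤ᵇ x a else true) (allFin j)) (allFin j)

balanced : {j : ℕ} → ℕ → List (Fin j) → Bool
balanced {j} n w = allB (λ i → ⌊ occ i w ℕ.≟ n ⌋) (allFin j)

ballot : {j : ℕ} → List (Fin j) → Bool
ballot w = allB (λ p → weaklyDecreasing (point p)) (inits w)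

isBBP : (j n : ℕ) → List (Fin j) → Bool
isBBP j n w = balanced n w ∧ ballot w

C : ℕ → ℕ → ℕ
C j n = countB (isBBP j n) (words j (j * n))

-- semisymmetric height g_k(x) = Σ_{i=1}^k (k+1-2i) x_i ; with 0-based index t = i-1
-- the coefficient is k - (2t+1).
sumFin : (k : ℕ) → (Fin k → ℤ) → ℤ
sumFin k f = foldr ℤ._+_ (+ 0) (map f (allFin k))

g : (k : ℕ) → (Fin k → ℕ) → ℤ
g k x = sumFin k (λ t → ((+ k) - (+ (2 * toℕ t ℕ.+ 1))) ℤ.* (+ x t))

-- semisymmetric height of a path: maximum of g_k over its intermediate points
-- (all prefixes, including the empty one, which always occurs so 0 is a valid seed).
height : (k : ℕ) → List (Fin k) → ℤ
height k w = foldr (λ p m → g k (point p) ⊔ m) (g k (point {k} [])) (inits w)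

D' : (k : ℕ) → ℤ → ℕ → ℕ
D' k u n = countB (λ w → isBBP k n w ∧ ⌊ height k w ℤ.≟ u ⌋) (words k (k * n))

{-# OPTIONS --safe #-}
module Submission where

-- Write k = 2m.  The coefficients of g_{2m} are positive on the first m coordinates and
-- negative on the last m, so on points with all coordinates in [0, n] the height g_{2m}
-- is maximal, with value m²n, exactly at the peak (n,…,n,0,…,0).  The points of a
-- balanced path of length 2mn lie in that box, so such a path has height m²n iff it
-- passes through the peak, i.e. iff its first mn steps use only e_1,…,e_m and the
-- remaining ones only e_{m+1},…,e_{2m}.  For such a path the ballot condition splits
-- into the ballot conditions of its two halves, which are arbitrary m-dimensional
-- balanced ballot paths; hence D'_{2m,m²n,n} = C_{m,n}².
open import Defs
open import Data.Nat using (ℕ; _*_; _≤_; _/_)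
open import Data.Nat.Divisibility using (_∣_)
open import Data.Integer using (+_)
open import Relation.Binary.PropositionalEquality using (_≡_)

open import Data.Nat using (zero; suc; _+_; _<_; z≤n; _≤ᵇ_)
import Data.Nat.Properties as ℕₚ
open import Data.Nat.DivMod using (m*n/n≡m)
open import Data.Nat.Divisibility using (divides)
open import Data.Nat.ListAction using (sum)
open import Data.Nat.ListAction.Properties using (sum-++)
import Data.Nat.Tactic.RingSolver as ℕ-Solver
open import Algebra.Properties.CommutativeSemigroup ℕₚ.+-commutativeSemigroup using (interchange)
open import Data.Integer as ℤ using (ℤ; +[1+_]; -[1+_]; +≤+; _⊔_)
import Data.Integer.Properties as ℤₚ
import Data.Integer.Tactic.RingSolver as ℤ-Solver
open import Data.Fin as Fin using (Fin; toℕ; _↑ˡ_; _↑ʳ_; splitAt)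
import Data.Fin.Properties as Finₚ
open import Data.Vec.Functional as Vector using (replicate)
import Data.Vec.Functional.Properties as Vectorₚ
open import Data.Bool using (Bool; true; false; _∧_; if_then_else_; T)
open import Data.Bool.Properties using (T-∧; T-≡; ⇔→≡)
open import Data.List using (List; []; _∷_; map; concatMap; allFin; inits; foldr; length; _++_)
import Data.List.Properties as Listₚ
open import Data.List.Relation.Unary.All as All using (All; []; _∷_)
open import Data.List.Membership.Propositional using (_∈_)
open import Data.List.Membership.Propositional.Properties using (∈-map⁺; ∈-map⁻; ∈-allFin)
open import Data.List.Relation.Unary.Any using (here; there)
open import Data.Product using (∃; ∃₂; _×_; _,_; proj₁; proj₂)
open import Data.Product.Function.NonDependent.Propositional using (_×-⇔_)
open import Data.Sum using (_⊎_; inj₁; inj₂)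
open import Data.Empty using (⊥-elim)
open import Data.Unit using (tt)
open import Function using (_∘_; _⇔_; mk⇔; Equivalence)
import Function.Properties.Equivalence as ⇔
open import Relation.Nullary using (¬_; yes; no)
open import Relation.Nullary.Decidable using (⌊_⌋; toWitness; fromWitness)
open import Relation.Binary.PropositionalEquality
  using (_≢_; _≗_; refl; sym; trans; cong; cong₂; subst; subst₂; module ≡-Reasoning)

open Equivalence using (to; from)

private
  variable
    A B : Set

∑ : List A → (A → ℕ) → ℕ
∑ xs f = sum (map f xs)

syntax ∑ xs (λ x → e) = ∑[ x ∈ xs ] e

∑-cong : ∀ {f h : A → ℕ} (xs : List A) → (∀ x → f x ≡ h x) → ∑ xs f ≡ ∑ xs h
∑-cong xs eq = cong sum (Listₚ.map-cong eq xs)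

∑-zero : ∀ {f : A → ℕ} (xs : List A) → (∀ x → f x ≡ 0) → ∑ xs f ≡ 0
∑-zero []       eq = refl
∑-zero (x ∷ xs) eq = cong₂ _+_ (eq x) (∑-zero xs eq)

∑-++ : ∀ (xs ys : List A) (f : A → ℕ) → ∑ (xs ++ ys) f ≡ ∑ xs f + ∑ ys f
∑-++ xs ys f = trans (cong sum (Listₚ.map-++ f xs ys)) (sum-++ (map f xs) (map f ys))

∑-map : ∀ (g : A → B) (xs : List A) (f : B → ℕ) → ∑ (map g xs) f ≡ ∑[ x ∈ xs ] f (g x)
∑-map g xs f = cong sum (sym (Listₚ.map-∘ xs))

∑-concatMap : ∀ (g : A → List B) (xs : List A) (f : B → ℕ) →
              ∑ (concatMap g xs) f ≡ ∑[ x ∈ xs ] ∑ (g x) f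
∑-concatMap g []       f = refl
∑-concatMap g (x ∷ xs) f =
  trans (∑-++ (g x) (concatMap g xs) f) (cong (_+_ (∑ (g x) f)) (∑-concatMap g xs f))

∑-const : ∀ (xs : List A) c → ∑[ x ∈ xs ] c ≡ length xs * c
∑-const []       c = refl
∑-const (x ∷ xs) c = cong (_+_ c) (∑-const xs c)

∑-+ : ∀ (xs : List A) (f h : A → ℕ) → ∑[ x ∈ xs ] (f x + h x) ≡ ∑ xs f + ∑ xs h
∑-+ []       f h = refl
∑-+ (x ∷ xs) f h = trans (cong (_+_ (f x + h x)) (∑-+ xs f h)) (interchange (f x) (h x) _ _)

∑-*ˡ : ∀ (xs : List A) (f : A → ℕ) c → ∑[ x ∈ xs ] (c * f x) ≡ c * ∑ xs f
∑-*ˡ []       f c = sym (ℕₚ.*-zeroʳ c)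
∑-*ˡ (x ∷ xs) f c = trans (cong (_+_ (c * f x)) (∑-*ˡ xs f c)) (sym (ℕₚ.*-distribˡ-+ c (f x) _))

∑-*ʳ : ∀ (xs : List A) (f : A → ℕ) c → ∑[ x ∈ xs ] (f x * c) ≡ ∑ xs f * c
∑-*ʳ xs f c = trans (∑-cong xs (λ x → ℕₚ.*-comm (f x) c)) (trans (∑-*ˡ xs f c) (ℕₚ.*-comm c _))

data Block (m n : ℕ) : Fin (m + n) → Set where
  left  : (i : Fin m) → Block m n (i ↑ˡ n)
  right : (i : Fin n) → Block m n (m ↑ʳ i)

block : ∀ m n (a : Fin (m + n)) → Block m n a
block m n a with splitAt m a in eq
... | inj₁ i = subst (Block m n) (Finₚ.splitAt⁻¹-↑ˡ eq) (left i)
... | inj₂ i = subst (Block m n) (Finₚ.splitAt⁻¹-↑ʳ eq) (right i)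

↑ˡ≢↑ʳ : ∀ {m n} (i : Fin m) (j : Fin n) → i ↑ˡ n ≢ m ↑ʳ j
↑ˡ≢↑ʳ {m} {n} i j eq
  with () ← trans (sym (Finₚ.splitAt-↑ˡ m i n)) (trans (cong (splitAt m) eq) (Finₚ.splitAt-↑ʳ m n j))

allFin-suc : ∀ k → allFin (suc k) ≡ Fin.zero ∷ map Fin.suc (allFin k)
allFin-suc k = cong (Fin.zero ∷_) (sym (Listₚ.map-tabulate (λ i → i) Fin.suc))

allFin-+ : ∀ m n → allFin (m + n) ≡ map (_↑ˡ n) (allFin m) ++ map (m ↑ʳ_) (allFin n)
allFin-+ zero n = sym (Listₚ.map-id (allFin n))
allFin-+ (suc m) n = begin
  allFin (suc m + n)
    ≡⟨ allFin-suc (m + n) ⟩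
  Fin.zero ∷ map Fin.suc (allFin (m + n))
    ≡⟨ cong (λ xs → Fin.zero ∷ map Fin.suc xs) (allFin-+ m n) ⟩
  Fin.zero ∷ map Fin.suc (map (_↑ˡ n) (allFin m) ++ map (m ↑ʳ_) (allFin n))
    ≡⟨ cong (Fin.zero ∷_) (Listₚ.map-++ Fin.suc (map (_↑ˡ n) (allFin m)) _) ⟩
  Fin.zero ∷ map Fin.suc (map (_↑ˡ n) (allFin m)) ++ map Fin.suc (map (m ↑ʳ_) (allFin n))
    ≡⟨ cong₂ (λ xs ys → Fin.zero ∷ xs ++ ys)
             (trans (sym (Listₚ.map-∘ (allFin m))) (Listₚ.map-∘ (allFin m))) (sym (Listₚ.map-∘ (allFin n))) ⟩
  map (_↑ˡ n) (Fin.zero ∷ map Fin.suc (allFin m)) ++ map (suc m ↑ʳ_) (allFin n)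
    ≡⟨ cong (λ xs → map (_↑ˡ n) xs ++ map (suc m ↑ʳ_) (allFin n)) (sym (allFin-suc m)) ⟩
  map (_↑ˡ n) (allFin (suc m)) ++ map (suc m ↑ʳ_) (allFin n) ∎
  where open ≡-Reasoning

∑-allFin-suc : ∀ k (h : Fin (suc k) → ℕ) →
               ∑ (allFin (suc k)) h ≡ h Fin.zero + ∑[ i ∈ allFin k ] h (Fin.suc i)
∑-allFin-suc k h =
  trans (cong (λ xs → ∑ xs h) (allFin-suc k)) (cong (_+_ (h Fin.zero)) (∑-map Fin.suc (allFin k) h))

∑-allFin-+ : ∀ m n (h : Fin (m + n) → ℕ) →
             ∑ (allFin (m + n)) h ≡ ∑[ i ∈ allFin m ] h (i ↑ˡ n) + ∑[ i ∈ allFin n ] h (m ↑ʳ i)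
∑-allFin-+ m n h = begin
  ∑ (allFin (m + n)) h
    ≡⟨ cong (λ xs → ∑ xs h) (allFin-+ m n) ⟩
  ∑ (map (_↑ˡ n) (allFin m) ++ map (m ↑ʳ_) (allFin n)) h
    ≡⟨ ∑-++ (map (_↑ˡ n) (allFin m)) _ h ⟩
  ∑ (map (_↑ˡ n) (allFin m)) h + ∑ (map (m ↑ʳ_) (allFin n)) h
    ≡⟨ cong₂ _+_ (∑-map (_↑ˡ n) (allFin m) h) (∑-map (m ↑ʳ_) (allFin n) h) ⟩
  ∑[ i ∈ allFin m ] h (i ↑ˡ n) + ∑[ i ∈ allFin n ] h (m ↑ʳ i) ∎
  where open ≡-Reasoning

Image : (A → B) → B → Set
Image ι b = ∃ λ a → ι a ≡ b

∑-allFin-↑ˡ : ∀ m n (h : Fin (m + n) → ℕ) → (∀ a → ¬ Image (_↑ˡ n) a → h a ≡ 0) →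
              ∑ (allFin (m + n)) h ≡ ∑[ i ∈ allFin m ] h (i ↑ˡ n)
∑-allFin-↑ˡ m n h vanish = begin
  ∑ (allFin (m + n)) h
    ≡⟨ ∑-allFin-+ m n h ⟩
  ∑[ i ∈ allFin m ] h (i ↑ˡ n) + ∑[ j ∈ allFin n ] h (m ↑ʳ j)
    ≡⟨ cong (_+_ _) (∑-zero (allFin n) (λ j → vanish (m ↑ʳ j) (λ (i , eq) → ↑ˡ≢↑ʳ i j eq))) ⟩
  ∑[ i ∈ allFin m ] h (i ↑ˡ n) + 0
    ≡⟨ ℕₚ.+-identityʳ _ ⟩
  ∑[ i ∈ allFin m ] h (i ↑ˡ n) ∎
  where open ≡-Reasoning

∑-allFin-↑ʳ : ∀ m n (h : Fin (m + n) → ℕ) → (∀ a → ¬ Image (m ↑ʳ_) a → h a ≡ 0) →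
              ∑ (allFin (m + n)) h ≡ ∑[ j ∈ allFin n ] h (m ↑ʳ j)
∑-allFin-↑ʳ m n h vanish = trans (∑-allFin-+ m n h) (cong (_+ ∑[ j ∈ allFin n ] h (m ↑ʳ j))
  (∑-zero (allFin m) (λ i → vanish (i ↑ˡ n) (λ (j , eq) → ↑ˡ≢↑ʳ i j (sym eq)))))

sumℤ : List ℤ → ℤ
sumℤ = foldr ℤ._+_ (+ 0)

sumFin-suc : ∀ k (f : Fin (suc k) → ℤ) → sumFin (suc k) f ≡ f Fin.zero ℤ.+ sumFin k (f ∘ Fin.suc)
sumFin-suc k f = trans (cong (λ xs → sumℤ (map f xs)) (allFin-suc k))
                       (cong (λ xs → f Fin.zero ℤ.+ sumℤ xs) (sym (Listₚ.map-∘ (allFin k))))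

sumℤ-++ : ∀ xs ys → sumℤ (xs ++ ys) ≡ sumℤ xs ℤ.+ sumℤ ys
sumℤ-++ []       ys = sym (ℤₚ.+-identityˡ (sumℤ ys))
sumℤ-++ (x ∷ xs) ys = trans (cong (ℤ._+_ x) (sumℤ-++ xs ys)) (sym (ℤₚ.+-assoc x (sumℤ xs) (sumℤ ys)))

sumℤ-zero : ∀ {f : A → ℤ} xs → (∀ x → f x ≡ + 0) → sumℤ (map f xs) ≡ + 0
sumℤ-zero []       eq = refl
sumℤ-zero (x ∷ xs) eq = cong₂ ℤ._+_ (eq x) (sumℤ-zero xs eq)

sumℤ-mono-≤ : ∀ {f h : A → ℤ} xs → (∀ x → f x ℤ.≤ h x) → sumℤ (map f xs) ℤ.≤ sumℤ (map h xs)
sumℤ-mono-≤ []       le = ℤₚ.≤-refl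
sumℤ-mono-≤ (x ∷ xs) le = ℤₚ.+-mono-≤ (le x) (sumℤ-mono-≤ xs le)

+-mono-≤-≡⇒≡ : ∀ {a b c d} → a ℤ.≤ b → c ℤ.≤ d → a ℤ.+ c ≡ b ℤ.+ d → a ≡ b × c ≡ d
+-mono-≤-≡⇒≡ a≤b c≤d eq =
  ℤₚ.≤-antisym a≤b (ℤₚ.≮⇒≥ (λ a<b → ℤₚ.<-irrefl eq (ℤₚ.+-mono-<-≤ a<b c≤d))) ,
  ℤₚ.≤-antisym c≤d (ℤₚ.≮⇒≥ (λ c<d → ℤₚ.<-irrefl eq (ℤₚ.+-mono-≤-< a≤b c<d)))

sumℤ-mono-≤-≡⇒≡ : ∀ {f h : A → ℤ} xs → (∀ x → f x ℤ.≤ h x) →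
                  sumℤ (map f xs) ≡ sumℤ (map h xs) → All (λ x → f x ≡ h x) xs
sumℤ-mono-≤-≡⇒≡ []       le eq = []
sumℤ-mono-≤-≡⇒≡ (x ∷ xs) le eq =
  let fx≡hx , rest = +-mono-≤-≡⇒≡ (le x) (sumℤ-mono-≤ xs le) eq
  in fx≡hx ∷ sumℤ-mono-≤-≡⇒≡ xs le rest

sumFin-cong : ∀ k {f h : Fin k → ℤ} → f ≗ h → sumFin k f ≡ sumFin k h
sumFin-cong k eq = cong sumℤ (Listₚ.map-cong eq (allFin k))

sumFin-+ : ∀ m n (f : Fin (m + n) → ℤ) →
           sumFin (m + n) f ≡ sumFin m (λ i → f (i ↑ˡ n)) ℤ.+ sumFin n (λ i → f (m ↑ʳ i))
sumFin-+ m n f = begin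
  sumℤ (map f (allFin (m + n)))
    ≡⟨ cong (sumℤ ∘ map f) (allFin-+ m n) ⟩
  sumℤ (map f (map (_↑ˡ n) (allFin m) ++ map (m ↑ʳ_) (allFin n)))
    ≡⟨ cong sumℤ (Listₚ.map-++ f (map (_↑ˡ n) (allFin m)) _) ⟩
  sumℤ (map f (map (_↑ˡ n) (allFin m)) ++ map f (map (m ↑ʳ_) (allFin n)))
    ≡⟨ sumℤ-++ (map f (map (_↑ˡ n) (allFin m))) _ ⟩
  sumℤ (map f (map (_↑ˡ n) (allFin m))) ℤ.+ sumℤ (map f (map (m ↑ʳ_) (allFin n)))
    ≡⟨ cong₂ (λ xs ys → sumℤ xs ℤ.+ sumℤ ys)
             (sym (Listₚ.map-∘ (allFin m))) (sym (Listₚ.map-∘ (allFin n))) ⟩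
  sumFin m (λ i → f (i ↑ˡ n)) ℤ.+ sumFin n (λ i → f (m ↑ʳ i)) ∎
  where open ≡-Reasoning

sumFin-odd : ∀ j (K N : ℤ) →
             sumFin j (λ i → (K ℤ.- + (2 * toℕ i + 1)) ℤ.* N) ≡ (+ j ℤ.* K ℤ.- + j ℤ.* + j) ℤ.* N
sumFin-odd zero    K N = refl
sumFin-odd (suc j) K N = begin
  sumFin (suc j) (term K)
    ≡⟨ sumFin-suc j (term K) ⟩
  (K ℤ.- + 1) ℤ.* N ℤ.+ sumFin j (term K ∘ Fin.suc)
    ≡⟨ cong (ℤ._+_ ((K ℤ.- + 1) ℤ.* N)) (sumFin-cong j (cong (ℤ._* N) ∘ shift K ∘ toℕ)) ⟩
  (K ℤ.- + 1) ℤ.* N ℤ.+ sumFin j (term (K ℤ.- + 2))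
    ≡⟨ cong (ℤ._+_ ((K ℤ.- + 1) ℤ.* N)) (sumFin-odd j (K ℤ.- + 2) N) ⟩
  (K ℤ.- + 1) ℤ.* N ℤ.+ (+ j ℤ.* (K ℤ.- + 2) ℤ.- + j ℤ.* + j) ℤ.* N
    ≡⟨ step K N (+ j) ⟩
  (+ suc j ℤ.* K ℤ.- + suc j ℤ.* + suc j) ℤ.* N ∎
  where
  open ≡-Reasoning
  term : ∀ {k} → ℤ → Fin k → ℤ
  term K i = (K ℤ.- + (2 * toℕ i + 1)) ℤ.* N
  shift : ∀ K t → K ℤ.- + (2 * suc t + 1) ≡ (K ℤ.- + 2) ℤ.- + (2 * t + 1)
  shift K t = trans (cong (λ a → K ℤ.- + a) (double-suc t)) (sub-+ K (+ (2 * t + 1)))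
    where
    double-suc : ∀ t → 2 * suc t + 1 ≡ 2 + (2 * t + 1)
    double-suc = ℕ-Solver.solve-∀
    sub-+ : ∀ K a → K ℤ.- (+ 2 ℤ.+ a) ≡ (K ℤ.- + 2) ℤ.- a
    sub-+ = ℤ-Solver.solve-∀
  step : ∀ K N J → (K ℤ.- + 1) ℤ.* N ℤ.+ (J ℤ.* (K ℤ.- + 2) ℤ.- J ℤ.* J) ℤ.* N
                   ≡ ((+ 1 ℤ.+ J) ℤ.* K ℤ.- (+ 1 ℤ.+ J) ℤ.* (+ 1 ℤ.+ J)) ℤ.* N
  step = ℤ-Solver.solve-∀

indicator : Bool → ℕ
indicator true  = 1
indicator false = 0

indicator-∧ : ∀ a b → indicator (a ∧ b) ≡ indicator a * indicator b
indicator-∧ true  b = sym (ℕₚ.*-identityˡ (indicator b))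
indicator-∧ false b = refl

indicator-¬T : ∀ {b} → ¬ T b → indicator b ≡ 0
indicator-¬T {false} _  = refl
indicator-¬T {true}  ¬t = ⊥-elim (¬t tt)

countB≡∑ : ∀ (p : A → Bool) xs → countB p xs ≡ ∑[ x ∈ xs ] indicator (p x)
countB≡∑ p []       = refl
countB≡∑ p (x ∷ xs) with p x
... | true  = cong suc (countB≡∑ p xs)
... | false = countB≡∑ p xs

countB-∷ : ∀ (p : A → Bool) x xs → countB p (x ∷ xs) ≡ indicator (p x) + countB p xs
countB-∷ p x xs = trans (countB≡∑ p (x ∷ xs)) (cong (_+_ (indicator (p x))) (sym (countB≡∑ p xs)))

countB-++ : ∀ (p : A → Bool) xs ys → countB p (xs ++ ys) ≡ countB p xs + countB p ys
countB-++ p xs ys = begin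
  countB p (xs ++ ys)                          ≡⟨ countB≡∑ p (xs ++ ys) ⟩
  ∑ (xs ++ ys) (indicator ∘ p)                 ≡⟨ ∑-++ xs ys (indicator ∘ p) ⟩
  ∑ xs (indicator ∘ p) + ∑ ys (indicator ∘ p)  ≡⟨ sym (cong₂ _+_ (countB≡∑ p xs) (countB≡∑ p ys)) ⟩
  countB p xs + countB p ys                    ∎
  where open ≡-Reasoning

countB-map : ∀ (p : B → Bool) (f : A → B) xs → countB p (map f xs) ≡ countB (p ∘ f) xs
countB-map p f xs =
  trans (countB≡∑ p (map f xs)) (trans (∑-map f xs (indicator ∘ p)) (sym (countB≡∑ (p ∘ f) xs)))

countB-cong : ∀ {p q : A → Bool} → p ≗ q → ∀ xs → countB p xs ≡ countB q xs
countB-cong {p = p} {q} eq xs =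
  trans (countB≡∑ p xs) (trans (∑-cong xs (cong indicator ∘ eq)) (sym (countB≡∑ q xs)))

∑∑-indicator-∧ : ∀ (p : A → Bool) (q : B → Bool) xs ys →
                 ∑[ y ∈ ys ] ∑[ x ∈ xs ] indicator (p x ∧ q y) ≡ countB p xs * countB q ys
∑∑-indicator-∧ p q xs ys = begin
  ∑[ y ∈ ys ] ∑[ x ∈ xs ] indicator (p x ∧ q y)
    ≡⟨ ∑-cong ys (λ y → trans (∑-cong xs (λ x → indicator-∧ (p x) (q y)))
                              (∑-*ʳ xs (indicator ∘ p) (indicator (q y)))) ⟩
  ∑[ y ∈ ys ] ((∑[ x ∈ xs ] indicator (p x)) * indicator (q y))
    ≡⟨ ∑-*ˡ ys (indicator ∘ q) (∑[ x ∈ xs ] indicator (p x)) ⟩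
  (∑[ x ∈ xs ] indicator (p x)) * (∑[ y ∈ ys ] indicator (q y))
    ≡⟨ sym (cong₂ _*_ (countB≡∑ p xs) (countB≡∑ q ys)) ⟩
  countB p xs * countB q ys ∎
  where open ≡-Reasoning

∑-words-suc : ∀ j ℓ (f : List (Fin j) → ℕ) →
              ∑ (words j (suc ℓ)) f ≡ ∑[ w ∈ words j ℓ ] ∑[ a ∈ allFin j ] f (a ∷ w)
∑-words-suc j ℓ f = trans (∑-concatMap (λ w → map (_∷ w) (allFin j)) (words j ℓ) f)
                          (∑-cong (words j ℓ) (λ w → ∑-map (_∷ w) (allFin j) f))

∑-words-cong : ∀ j ℓ {f h : List (Fin j) → ℕ} →
               (∀ w → length w ≡ ℓ → f w ≡ h w) → ∑ (words j ℓ) f ≡ ∑ (words j ℓ) h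
∑-words-cong j zero    eq = cong (_+ 0) (eq [] refl)
∑-words-cong j (suc ℓ) {f} {h} eq = begin
  ∑ (words j (suc ℓ)) f
    ≡⟨ ∑-words-suc j ℓ f ⟩
  ∑[ w ∈ words j ℓ ] ∑[ a ∈ allFin j ] f (a ∷ w)
    ≡⟨ ∑-words-cong j ℓ (λ w |w| → ∑-cong (allFin j) (λ a → eq (a ∷ w) (cong suc |w|))) ⟩
  ∑[ w ∈ words j ℓ ] ∑[ a ∈ allFin j ] h (a ∷ w)
    ≡⟨ sym (∑-words-suc j ℓ h) ⟩
  ∑ (words j (suc ℓ)) h ∎
  where open ≡-Reasoning

∑-words-zero : ∀ j ℓ {f : List (Fin j) → ℕ} →
               (∀ w → length w ≡ ℓ → f w ≡ 0) → ∑ (words j ℓ) f ≡ 0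
∑-words-zero j ℓ eq = trans (∑-words-cong j ℓ eq) (∑-zero (words j ℓ) (λ _ → refl))

∑-words-++ : ∀ j a b (f : List (Fin j) → ℕ) →
             ∑ (words j (a + b)) f ≡ ∑[ v ∈ words j b ] ∑[ u ∈ words j a ] f (u ++ v)
∑-words-++ j zero    b f = ∑-cong (words j b) (λ v → sym (ℕₚ.+-identityʳ (f v)))
∑-words-++ j (suc a) b f = begin
  ∑ (words j (suc a + b)) f
    ≡⟨ ∑-words-suc j (a + b) f ⟩
  ∑[ w ∈ words j (a + b) ] ∑[ c ∈ allFin j ] f (c ∷ w)
    ≡⟨ ∑-words-++ j a b _ ⟩
  ∑[ v ∈ words j b ] ∑[ u ∈ words j a ] ∑[ c ∈ allFin j ] f (c ∷ u ++ v)
    ≡⟨ ∑-cong (words j b) (λ v → sym (∑-words-suc j a (λ u → f (u ++ v)))) ⟩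
  ∑[ v ∈ words j b ] ∑[ u ∈ words j (suc a) ] f (u ++ v) ∎
  where open ≡-Reasoning

∑-words-restrict : ∀ {j m} (ι : Fin m → Fin j) →
                   (∀ h → (∀ a → ¬ Image ι a → h a ≡ 0) →
                          ∑ (allFin j) h ≡ ∑[ t ∈ allFin m ] h (ι t)) →
                   ∀ ℓ {f} → (∀ w → length w ≡ ℓ → ¬ All (Image ι) w → f w ≡ 0) →
                   ∑ (words j ℓ) f ≡ ∑[ w ∈ words m ℓ ] f (map ι w)
∑-words-restrict ι restrict zero    vanish = refl
∑-words-restrict {j} {m} ι restrict (suc ℓ) {f} vanish = begin
  ∑ (words j (suc ℓ)) f
    ≡⟨ ∑-words-suc j ℓ f ⟩
  ∑[ w ∈ words j ℓ ] ∑[ a ∈ allFin j ] f (a ∷ w)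
    ≡⟨ ∑-words-restrict ι restrict ℓ (λ w |w| ¬ιw →
         ∑-zero (allFin j) (λ a → vanish (a ∷ w) (cong suc |w|) (¬ιw ∘ All.tail))) ⟩
  ∑[ w ∈ words m ℓ ] ∑[ a ∈ allFin j ] f (a ∷ map ι w)
    ≡⟨ ∑-words-cong m ℓ (λ w |w| → restrict _ (λ a ¬ιa →
         vanish (a ∷ map ι w) (cong suc (trans (Listₚ.length-map ι w) |w|)) (¬ιa ∘ All.head))) ⟩
  ∑[ w ∈ words m ℓ ] ∑[ t ∈ allFin m ] f (ι t ∷ map ι w)
    ≡⟨ sym (∑-words-suc m ℓ (f ∘ map ι)) ⟩
  ∑[ w ∈ words m (suc ℓ) ] f (map ι w) ∎
  where open ≡-Reasoning

-- Balanced ballot paths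

Balanced : ∀ {j} → ℕ → List (Fin j) → Set
Balanced n w = ∀ a → occ a w ≡ n

WeaklyDecreasing : ∀ {j} → (Fin j → ℕ) → Set
WeaklyDecreasing x = ∀ a b → a Fin.≤ b → x b ≤ x a

Ballot : ∀ {j} → List (Fin j) → Set
Ballot w = ∀ p q → p ++ q ≡ w → WeaklyDecreasing (point p)

∈-inits⁺ : ∀ {p q w : List A} → p ++ q ≡ w → p ∈ inits w
∈-inits⁺ {p = []}    _    = here refl
∈-inits⁺ {p = x ∷ p} refl = there (∈-map⁺ (x ∷_) (∈-inits⁺ refl))

∈-inits⁻ : ∀ {p : List A} w → p ∈ inits w → ∃ λ q → p ++ q ≡ w
∈-inits⁻ w       (here refl) = w , refl
∈-inits⁻ (x ∷ w) (there mem) with ∈-map⁻ (x ∷_) mem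
... | p , p∈ , refl = let q , eq = ∈-inits⁻ w p∈ in q , cong (x ∷_) eq

All-inits : ∀ {P : List A → Set} w → All P (inits w) ⇔ (∀ p q → p ++ q ≡ w → P p)
All-inits w = mk⇔
  (λ all p q pq → All.lookup all (∈-inits⁺ pq))
  (λ h → All.tabulate (λ {p} mem → h p _ (proj₂ (∈-inits⁻ w mem))))

All-allFin : ∀ {k} {P : Fin k → Set} → All P (allFin k) ⇔ (∀ a → P a)
All-allFin = mk⇔ (λ all a → All.lookup all (∈-allFin a)) (λ h → All.tabulate (λ {a} _ → h a))

T-allB : ∀ (p : A → Bool) xs → T (allB p xs) ⇔ All (T ∘ p) xs
T-allB p []       = mk⇔ (λ _ → []) (λ _ → tt)
T-allB p (x ∷ xs) = mk⇔
  (λ t → let px , pxs = to T-∧ t in px ∷ to (T-allB p xs) pxs)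
  (λ { (px ∷ pxs) → from T-∧ (px , from (T-allB p xs) pxs) })

T-allB-allFin : ∀ {k} (p : Fin k → Bool) → T (allB p (allFin k)) ⇔ (∀ a → T (p a))
T-allB-allFin {k} p = ⇔.trans (T-allB p (allFin k)) All-allFin

T-if-else-true : ∀ c d → T (if c then d else true) ⇔ (T c → T d)
T-if-else-true true  d = mk⇔ (λ t _ → t) (λ f → f tt)
T-if-else-true false d = mk⇔ (λ _ ()) (λ _ → tt)

T-weaklyDecreasing : ∀ {j} (x : Fin j → ℕ) → T (weaklyDecreasing x) ⇔ WeaklyDecreasing x
T-weaklyDecreasing {j} x = mk⇔
  (λ t a b a≤b → ℕₚ.≤ᵇ⇒≤ (x b) (x a)
     (to (T-if-else-true _ _) (to (T-allB-allFin (entry a)) (to (T-allB-allFin row) t a) b) (ℕₚ.≤⇒≤ᵇ a≤b)))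
  (λ wd → from (T-allB-allFin row) (λ a → from (T-allB-allFin (entry a)) (λ b →
     from (T-if-else-true _ _) (λ a≤ᵇb → ℕₚ.≤⇒≤ᵇ (wd a b (ℕₚ.≤ᵇ⇒≤ _ _ a≤ᵇb))))))
  where
  entry : Fin j → Fin j → Bool
  entry a b = if toℕ a ≤ᵇ toℕ b then x b ≤ᵇ x a else true
  row : Fin j → Bool
  row a = allB (entry a) (allFin j)

T-balanced : ∀ {j} n (w : List (Fin j)) → T (balanced n w) ⇔ Balanced n w
T-balanced n w = mk⇔
  (λ t a → toWitness (to (T-allB-allFin (λ i → ⌊ occ i w ℕₚ.≟ n ⌋)) t a))
  (λ bal → from (T-allB-allFin (λ i → ⌊ occ i w ℕₚ.≟ n ⌋)) (λ a → fromWitness (bal a)))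

T-ballot : ∀ {j} (w : List (Fin j)) → T (ballot w) ⇔ Ballot w
T-ballot {j} w = mk⇔
  (λ t p q pq → to (T-weaklyDecreasing (point p)) (to (All-inits w) (to (T-allB wd (inits w)) t) p q pq))
  (λ bal → from (T-allB wd (inits w))
     (from (All-inits w) (λ p q pq → from (T-weaklyDecreasing (point p)) (bal p q pq))))
  where
  wd : List (Fin j) → Bool
  wd p = weaklyDecreasing (point p)

T-injective : ∀ {a b} → T a ⇔ T b → a ≡ b
T-injective a⇔b = ⇔→≡ (⇔.trans (⇔.sym T-≡) (⇔.trans a⇔b T-≡))

T-isBBP : ∀ j n (w : List (Fin j)) → T (isBBP j n w) ⇔ (Balanced n w × Ballot w)
T-isBBP j n w = ⇔.trans T-∧ (T-balanced n w ×-⇔ T-ballot w)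

occ-++ : ∀ {j} (a : Fin j) u v → occ a (u ++ v) ≡ occ a u + occ a v
occ-++ a = countB-++ (λ b → ⌊ b Finₚ.≟ a ⌋)

occ-map-injective : ∀ {j m} (ι : Fin m → Fin j) → (∀ {s t} → ι s ≡ ι t → s ≡ t) →
                    ∀ t w → occ (ι t) (map ι w) ≡ occ t w
occ-map-injective ι inj t w =
  trans (countB-map (λ b → ⌊ b Finₚ.≟ ι t ⌋) ι w) (countB-cong same w)
  where
  same : ∀ s → ⌊ ι s Finₚ.≟ ι t ⌋ ≡ ⌊ s Finₚ.≟ t ⌋
  same s with s Finₚ.≟ t | ι s Finₚ.≟ ι t
  ... | yes _    | yes _   = refl
  ... | no  _    | no  _   = refl
  ... | yes refl | no ιs≢ιs = ⊥-elim (ιs≢ιs refl)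
  ... | no s≢t   | yes ιs≡ιt = ⊥-elim (s≢t (inj ιs≡ιt))

occ-map-∉ : ∀ {j m} (ι : Fin m → Fin j) {a} → ¬ Image ι a → ∀ w → occ a (map ι w) ≡ 0
occ-map-∉ ι {a} ¬ιa w = begin
  occ a (map ι w)                                  ≡⟨ countB-map (λ b → ⌊ b Finₚ.≟ a ⌋) ι w ⟩
  countB (λ s → ⌊ ι s Finₚ.≟ a ⌋) w                ≡⟨ countB≡∑ _ w ⟩
  ∑[ s ∈ w ] indicator ⌊ ι s Finₚ.≟ a ⌋            ≡⟨ ∑-zero w (cong indicator ∘ miss) ⟩
  0                                                ∎
  where
  open ≡-Reasoning
  miss : ∀ s → ⌊ ι s Finₚ.≟ a ⌋ ≡ false
  miss s with ι s Finₚ.≟ a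
  ... | yes ιs≡a = ⊥-elim (¬ιa (s , ιs≡a))
  ... | no  _    = refl

∈⇒occ≢0 : ∀ {j} {a : Fin j} {w} → a ∈ w → occ a w ≢ 0
∈⇒occ≢0 {a = a} (here refl) with a Finₚ.≟ a
... | yes _   = λ ()
... | no a≢a = ⊥-elim (a≢a refl)
∈⇒occ≢0 {a = a} (there {x} mem) with x Finₚ.≟ a
... | yes _ = λ ()
... | no  _ = ∈⇒occ≢0 mem

∑-indicator-≟ : ∀ {j} (x : Fin j) → ∑[ a ∈ allFin j ] indicator ⌊ x Finₚ.≟ a ⌋ ≡ 1
∑-indicator-≟ {suc j} Fin.zero    =
  trans (∑-allFin-suc j (λ a → indicator ⌊ Fin.zero Finₚ.≟ a ⌋)) (cong suc (∑-zero (allFin j) (λ _ → refl)))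
∑-indicator-≟ {suc j} (Fin.suc x) = begin
  ∑[ a ∈ allFin (suc j) ] indicator ⌊ Fin.suc x Finₚ.≟ a ⌋
    ≡⟨ ∑-allFin-suc j (λ a → indicator ⌊ Fin.suc x Finₚ.≟ a ⌋) ⟩
  ∑[ i ∈ allFin j ] indicator ⌊ Fin.suc x Finₚ.≟ Fin.suc i ⌋
    ≡⟨ ∑-cong (allFin j) (cong indicator ∘ suc≟suc) ⟩
  ∑[ i ∈ allFin j ] indicator ⌊ x Finₚ.≟ i ⌋
    ≡⟨ ∑-indicator-≟ x ⟩
  1 ∎
  where
  open ≡-Reasoning
  suc≟suc : ∀ i → ⌊ Fin.suc x Finₚ.≟ Fin.suc i ⌋ ≡ ⌊ x Finₚ.≟ i ⌋
  suc≟suc i with x Finₚ.≟ i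
  ... | yes _ = refl
  ... | no  _ = refl

∑-occ : ∀ {j} (w : List (Fin j)) → ∑[ a ∈ allFin j ] occ a w ≡ length w
∑-occ {j} []      = ∑-zero (allFin j) (λ _ → refl)
∑-occ {j} (x ∷ w) = begin
  ∑[ a ∈ allFin j ] occ a (x ∷ w)
    ≡⟨ ∑-cong (allFin j) (λ a → countB-∷ (λ b → ⌊ b Finₚ.≟ a ⌋) x w) ⟩
  ∑[ a ∈ allFin j ] (indicator ⌊ x Finₚ.≟ a ⌋ + occ a w)
    ≡⟨ ∑-+ (allFin j) (λ a → indicator ⌊ x Finₚ.≟ a ⌋) (λ a → occ a w) ⟩
  ∑[ a ∈ allFin j ] indicator ⌊ x Finₚ.≟ a ⌋ + ∑[ a ∈ allFin j ] occ a w
    ≡⟨ cong₂ _+_ (∑-indicator-≟ x) (∑-occ w) ⟩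
  suc (length w) ∎
  where open ≡-Reasoning

prefix-point-≤ : ∀ {j n} {w : List (Fin j)} → Balanced n w → ∀ p q → p ++ q ≡ w → ∀ a → point p a ≤ n
prefix-point-≤ bal p q refl a =
  ℕₚ.≤-trans (ℕₚ.m≤m+n (occ a p) (occ a q)) (ℕₚ.≤-reflexive (trans (sym (occ-++ a p q)) (bal a)))

-- Concatenating paths in complementary blocks of coordinates

blocks : ∀ {m n} → List (Fin m) → List (Fin n) → List (Fin (m + n))
blocks {m} {n} u v = map (_↑ˡ n) u ++ map (m ↑ʳ_) v

point-blocks : ∀ {m n} (u : List (Fin m)) (v : List (Fin n)) → point (blocks u v) ≗ point u Vector.++ point v
point-blocks {m} {n} u v a with block m n a
... | left i = begin
  occ (i ↑ˡ n) (map (_↑ˡ n) u ++ map (m ↑ʳ_) v)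
    ≡⟨ occ-++ (i ↑ˡ n) (map (_↑ˡ n) u) (map (m ↑ʳ_) v) ⟩
  occ (i ↑ˡ n) (map (_↑ˡ n) u) + occ (i ↑ˡ n) (map (m ↑ʳ_) v)
    ≡⟨ cong₂ _+_ (occ-map-injective (_↑ˡ n) (Finₚ.↑ˡ-injective n _ _) i u)
                 (occ-map-∉ (m ↑ʳ_) (λ (j , eq) → ↑ˡ≢↑ʳ i j (sym eq)) v) ⟩
  occ i u + 0
    ≡⟨ ℕₚ.+-identityʳ (occ i u) ⟩
  occ i u
    ≡⟨ sym (Vectorₚ.lookup-++ˡ (point u) (point v) i) ⟩
  (point u Vector.++ point v) (i ↑ˡ n) ∎
  where open ≡-Reasoning
... | right j = begin
  occ (m ↑ʳ j) (map (_↑ˡ n) u ++ map (m ↑ʳ_) v)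
    ≡⟨ occ-++ (m ↑ʳ j) (map (_↑ˡ n) u) (map (m ↑ʳ_) v) ⟩
  occ (m ↑ʳ j) (map (_↑ˡ n) u) + occ (m ↑ʳ j) (map (m ↑ʳ_) v)
    ≡⟨ cong₂ _+_ (occ-map-∉ (_↑ˡ n) (λ (i , eq) → ↑ˡ≢↑ʳ i j eq) u)
                 (occ-map-injective (m ↑ʳ_) (Finₚ.↑ʳ-injective m _ _) j v) ⟩
  occ j v
    ≡⟨ sym (Vectorₚ.lookup-++ʳ (point u) (point v) j) ⟩
  (point u Vector.++ point v) (m ↑ʳ j) ∎
  where open ≡-Reasoning

WeaklyDecreasing-cong : ∀ {j} {x y : Fin j → ℕ} → x ≗ y → WeaklyDecreasing x → WeaklyDecreasing y
WeaklyDecreasing-cong x≗y wd a b a≤b = subst₂ _≤_ (x≗y b) (x≗y a) (wd a b a≤b)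

module _ {m n : ℕ} (x : Fin m → ℕ) (y : Fin n → ℕ) where

  WeaklyDecreasing-++⁻ˡ : WeaklyDecreasing (x Vector.++ y) → WeaklyDecreasing x
  WeaklyDecreasing-++⁻ˡ wd a b a≤b =
    subst₂ _≤_ (Vectorₚ.lookup-++ˡ x y b) (Vectorₚ.lookup-++ˡ x y a)
      (wd (a ↑ˡ n) (b ↑ˡ n) (subst₂ _≤_ (sym (Finₚ.toℕ-↑ˡ a n)) (sym (Finₚ.toℕ-↑ˡ b n)) a≤b))

  WeaklyDecreasing-++⁻ʳ : WeaklyDecreasing (x Vector.++ y) → WeaklyDecreasing y
  WeaklyDecreasing-++⁻ʳ wd a b a≤b =
    subst₂ _≤_ (Vectorₚ.lookup-++ʳ x y b) (Vectorₚ.lookup-++ʳ x y a)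
      (wd (m ↑ʳ a) (m ↑ʳ b)
        (subst₂ _≤_ (sym (Finₚ.toℕ-↑ʳ m a)) (sym (Finₚ.toℕ-↑ʳ m b)) (ℕₚ.+-monoʳ-≤ m a≤b)))

  WeaklyDecreasing-++⁺ : WeaklyDecreasing x → WeaklyDecreasing y → (∀ i j → y j ≤ x i) →
                         WeaklyDecreasing (x Vector.++ y)
  WeaklyDecreasing-++⁺ wdx wdy y≤x a b a≤b with block m n a | block m n b
  ... | left i  | left i′ = subst₂ _≤_ (sym (Vectorₚ.lookup-++ˡ x y i′)) (sym (Vectorₚ.lookup-++ˡ x y i))
                              (wdx i i′ (subst₂ _≤_ (Finₚ.toℕ-↑ˡ i n) (Finₚ.toℕ-↑ˡ i′ n) a≤b))
  ... | left i  | right j = subst₂ _≤_ (sym (Vectorₚ.lookup-++ʳ x y j)) (sym (Vectorₚ.lookup-++ˡ x y i))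
                              (y≤x i j)
  ... | right j | left i  =
    ⊥-elim (ℕₚ.<⇒≱ i<m+j (subst₂ _≤_ (Finₚ.toℕ-↑ʳ m j) (Finₚ.toℕ-↑ˡ i n) a≤b))
    where
    i<m+j : toℕ i < m + toℕ j
    i<m+j = ℕₚ.≤-trans (Finₚ.toℕ<n i) (ℕₚ.m≤m+n m (toℕ j))
  ... | right j | right j′ = subst₂ _≤_ (sym (Vectorₚ.lookup-++ʳ x y j′)) (sym (Vectorₚ.lookup-++ʳ x y j))
                               (wdy j j′ (ℕₚ.+-cancelˡ-≤ m _ _
                                 (subst₂ _≤_ (Finₚ.toℕ-↑ʳ m j) (Finₚ.toℕ-↑ʳ m j′) a≤b)))

prefix-++ : ∀ {p q x y : List A} → p ++ q ≡ x ++ y →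
            (∃ λ r → p ++ r ≡ x) ⊎ (∃ λ r → p ≡ x ++ r × r ++ q ≡ y)
prefix-++ {p = p}     {x = []}    eq = inj₂ (p , refl , eq)
prefix-++ {p = []}    {x = a ∷ x} eq = inj₁ (a ∷ x , refl)
prefix-++ {p = b ∷ p} {x = a ∷ x} eq with Listₚ.∷-injective eq
... | refl , eq′ with prefix-++ {p = p} {x = x} eq′
...   | inj₁ (r , pr)        = inj₁ (r , cong (b ∷_) pr)
...   | inj₂ (r , refl , rq) = inj₂ (r , refl , rq)

prefix-map : ∀ (f : A → B) {p q : List B} xs → p ++ q ≡ map f xs →
             ∃₂ λ p′ q′ → p ≡ map f p′ × p′ ++ q′ ≡ xs
prefix-map f {[]}    xs       eq = [] , xs , refl , refl
prefix-map f {b ∷ p} (x ∷ xs) eq with Listₚ.∷-injective eq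
... | refl , eq′ with prefix-map f {p} xs eq′
...   | p′ , q′ , refl , pq = x ∷ p′ , q′ , refl , cong (x ∷_) pq

++-length-injectiveˡ : ∀ {p q u v : List A} → p ++ q ≡ u ++ v → length p ≡ length u → p ≡ u
++-length-injectiveˡ {p = []}    {u = []}    _  _   = refl
++-length-injectiveˡ {p = x ∷ p} {u = y ∷ u} eq len with Listₚ.∷-injective eq
... | refl , eq′ = cong (x ∷_) (++-length-injectiveˡ eq′ (ℕₚ.suc-injective len))

module _ {m n : ℕ} where

  blocks-prefixˡ : ∀ {p q u : List (Fin m)} (v : List (Fin n)) → p ++ q ≡ u →
                   blocks p [] ++ blocks q v ≡ blocks u v
  blocks-prefixˡ {p} {q} v refl = begin
    (map (_↑ˡ n) p ++ []) ++ map (_↑ˡ n) q ++ map (m ↑ʳ_) v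
      ≡⟨ cong (_++ blocks q v) (Listₚ.++-identityʳ (map (_↑ˡ n) p)) ⟩
    map (_↑ˡ n) p ++ map (_↑ˡ n) q ++ map (m ↑ʳ_) v
      ≡⟨ sym (Listₚ.++-assoc (map (_↑ˡ n) p) (map (_↑ˡ n) q) _) ⟩
    (map (_↑ˡ n) p ++ map (_↑ˡ n) q) ++ map (m ↑ʳ_) v
      ≡⟨ cong (_++ map (m ↑ʳ_) v) (sym (Listₚ.map-++ (_↑ˡ n) p q)) ⟩
    map (_↑ˡ n) (p ++ q) ++ map (m ↑ʳ_) v ∎
    where open ≡-Reasoning

  blocks-prefixʳ : ∀ (u : List (Fin m)) {r s v : List (Fin n)} → r ++ s ≡ v →
                   blocks u r ++ blocks [] s ≡ blocks u v
  blocks-prefixʳ u {r} {s} refl = trans (Listₚ.++-assoc (map (_↑ˡ n) u) (map (m ↑ʳ_) r) _)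
                                        (cong (map (_↑ˡ n) u ++_) (sym (Listₚ.map-++ (m ↑ʳ_) r s)))

  prefix-blocks : ∀ {p q} (u : List (Fin m)) (v : List (Fin n)) → p ++ q ≡ blocks u v →
                  (∃₂ λ p′ q′ → p ≡ blocks p′ [] × p′ ++ q′ ≡ u) ⊎
                  (∃₂ λ r s → p ≡ blocks u r × r ++ s ≡ v)
  prefix-blocks {p} u v eq with prefix-++ {p = p} eq
  ... | inj₁ (r , pr) with prefix-map (_↑ˡ n) {p} u pr
  ...   | p′ , q′ , refl , pq = inj₁ (p′ , q′ , sym (Listₚ.++-identityʳ _) , pq)
  prefix-blocks u v eq | inj₂ (r , refl , rq) with prefix-map (m ↑ʳ_) {r} v rq
  ...   | r′ , s′ , refl , rs = inj₂ (r′ , s′ , refl , rs)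

  Balanced-blocks : ∀ {k} (u : List (Fin m)) (v : List (Fin n)) →
                    Balanced k (blocks u v) ⇔ (Balanced k u × Balanced k v)
  Balanced-blocks {k} u v = mk⇔
    (λ bal → (λ i → trans (sym (Vectorₚ.lookup-++ˡ (point u) (point v) i))
                          (trans (sym (point-blocks u v (i ↑ˡ n))) (bal (i ↑ˡ n)))) ,
             (λ j → trans (sym (Vectorₚ.lookup-++ʳ (point u) (point v) j))
                          (trans (sym (point-blocks u v (m ↑ʳ j))) (bal (m ↑ʳ j)))))
    (λ (balu , balv) a → trans (point-blocks u v a) (both balu balv a))
    where
    both : Balanced k u → Balanced k v → ∀ a → (point u Vector.++ point v) a ≡ k
    both balu balv a with block m n a
    ... | left i  = trans (Vectorₚ.lookup-++ˡ (point u) (point v) i) (balu i)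
    ... | right j = trans (Vectorₚ.lookup-++ʳ (point u) (point v) j) (balv j)

  Ballot-blocks⁻ : ∀ (u : List (Fin m)) (v : List (Fin n)) → Ballot (blocks u v) → Ballot u × Ballot v
  Ballot-blocks⁻ u v ballot =
    (λ p q pq → WeaklyDecreasing-++⁻ˡ (point p) (point {n} [])
       (WeaklyDecreasing-cong (point-blocks p [])
         (ballot (blocks p []) (blocks q v) (blocks-prefixˡ {p = p} {q = q} v pq)))) ,
    (λ r s rs → WeaklyDecreasing-++⁻ʳ (point u) (point r)
       (WeaklyDecreasing-cong (point-blocks u r)
         (ballot (blocks u r) (blocks [] s) (blocks-prefixʳ u {r = r} {s = s} rs))))

  -- Before the switch of blocks the last coordinates vanish; after it the first ones all
  -- equal k, which bounds every coordinate of a prefix of a balanced path.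
  Ballot-blocks⁺ : ∀ {k} (u : List (Fin m)) (v : List (Fin n)) → Balanced k u → Balanced k v →
                   Ballot u → Ballot v → Ballot (blocks u v)
  Ballot-blocks⁺ u v balu balv ballotu ballotv p _ pq with prefix-blocks {p} u v pq
  ... | inj₁ (p′ , q′ , refl , p′q′) =
    WeaklyDecreasing-cong (sym ∘ point-blocks p′ [])
      (WeaklyDecreasing-++⁺ (point p′) (point []) (ballotu p′ q′ p′q′) (λ _ _ _ → z≤n) (λ _ _ → z≤n))
  ... | inj₂ (r , s , refl , rs) =
    WeaklyDecreasing-cong (sym ∘ point-blocks u r)
      (WeaklyDecreasing-++⁺ (point u) (point r) (ballotu u [] (Listₚ.++-identityʳ u)) (ballotv r s rs)
        (λ i j → subst (point r j ≤_) (sym (balu i)) (prefix-point-≤ balv r s rs j)))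

-- The height of a path as a maximum over its prefixes

module _ {A : Set} (G : A → ℤ) where

  ≤-foldr-⊔ : ∀ s {x} xs → x ∈ xs → G x ℤ.≤ foldr (λ y acc → G y ⊔ acc) s xs
  ≤-foldr-⊔ s (y ∷ xs) (here refl) = ℤₚ.i≤i⊔j (G y) _
  ≤-foldr-⊔ s (y ∷ xs) (there mem) = ℤₚ.≤-trans (≤-foldr-⊔ s xs mem) (ℤₚ.i≤j⊔i (G y) _)

  foldr-⊔-≤ : ∀ {s B} xs → s ℤ.≤ B → All (λ x → G x ℤ.≤ B) xs →
              foldr (λ y acc → G y ⊔ acc) s xs ℤ.≤ B
  foldr-⊔-≤ []       s≤B []           = s≤B
  foldr-⊔-≤ (x ∷ xs) s≤B (Gx≤B ∷ all) = ℤₚ.⊔-lub Gx≤B (foldr-⊔-≤ xs s≤B all)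

  foldr-⊔-sel : ∀ s xs → let M = foldr (λ y acc → G y ⊔ acc) s xs in
                M ≡ s ⊎ ∃ λ x → x ∈ xs × M ≡ G x
  foldr-⊔-sel s []       = inj₁ refl
  foldr-⊔-sel s (x ∷ xs) with ℤₚ.⊔-sel (G x) (foldr (λ y acc → G y ⊔ acc) s xs)
  ... | inj₁ eq = inj₂ (x , here refl , eq)
  ... | inj₂ eq with foldr-⊔-sel s xs
  ...   | inj₁ eq′               = inj₁ (trans eq eq′)
  ...   | inj₂ (y , mem , eq′)   = inj₂ (y , there mem , trans eq eq′)

≤-height : ∀ k {w : List (Fin k)} p q → p ++ q ≡ w → g k (point p) ℤ.≤ height k w
≤-height k {w} p q pq = ≤-foldr-⊔ (g k ∘ point) _ (inits w) (∈-inits⁺ {p = p} pq)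

height-≤ : ∀ k (w : List (Fin k)) {B} →
           (∀ p q → p ++ q ≡ w → g k (point p) ℤ.≤ B) → height k w ℤ.≤ B
height-≤ k w h = foldr-⊔-≤ (g k ∘ point) (inits w) (h [] w refl) (from (All-inits w) h)

height-attained : ∀ k (w : List (Fin k)) → ∃₂ λ p q → p ++ q ≡ w × height k w ≡ g k (point p)
height-attained k w with foldr-⊔-sel (g k ∘ point) (g k (point {k} [])) (inits w)
... | inj₁ eq             = [] , w , refl , eq
... | inj₂ (p , mem , eq) = let q , pq = ∈-inits⁻ w mem in p , q , pq , eq

-- The semisymmetric height in even dimension

even-minus-odd-positive : ∀ {a m} → a < m → ∃ λ c → + (m + m) ℤ.- + (2 * a + 1) ≡ +[1+ c ]
even-minus-odd-positive {a} a<m with ℕₚ.m≤n⇒∃[o]m+o≡n a<m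
... | d , refl = d + d , (begin
  + ((suc a + d) + (suc a + d)) ℤ.- + (2 * a + 1)
    ≡⟨ cong (λ z → + z ℤ.- + (2 * a + 1)) (regroup a d) ⟩
  + ((2 * a + 1) + suc (d + d)) ℤ.- + (2 * a + 1)
    ≡⟨ add-sub-cancel (+ (2 * a + 1)) +[1+ d + d ] ⟩
  +[1+ d + d ] ∎)
  where
  open ≡-Reasoning
  regroup : ∀ a d → (suc a + d) + (suc a + d) ≡ (2 * a + 1) + suc (d + d)
  regroup = ℕ-Solver.solve-∀
  add-sub-cancel : ∀ x y → x ℤ.+ y ℤ.- x ≡ y
  add-sub-cancel = ℤ-Solver.solve-∀

even-minus-odd-negative : ∀ {a m} → m ≤ a → ∃ λ c → + (m + m) ℤ.- + (2 * a + 1) ≡ -[1+ c ]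
even-minus-odd-negative {m = m} m≤a with ℕₚ.m≤n⇒∃[o]m+o≡n m≤a
... | d , refl = d + d , (begin
  + (m + m) ℤ.- + (2 * (m + d) + 1)
    ≡⟨ cong (λ z → + (m + m) ℤ.- + z) (regroup m d) ⟩
  + (m + m) ℤ.- + ((m + m) + suc (d + d))
    ≡⟨ sub-add-cancel (+ (m + m)) +[1+ d + d ] ⟩
  -[1+ d + d ] ∎)
  where
  open ≡-Reasoning
  regroup : ∀ m d → 2 * (m + d) + 1 ≡ (m + m) + suc (d + d)
  regroup = ℕ-Solver.solve-∀
  sub-add-cancel : ∀ x y → x ℤ.- (x ℤ.+ y) ≡ ℤ.- y
  sub-add-cancel = ℤ-Solver.solve-∀

coeff : (k : ℕ) → Fin k → ℤ
coeff k t = + k ℤ.- + (2 * toℕ t + 1)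

coeff-↑ˡ : ∀ m (i : Fin m) → ∃ λ c → coeff (m + m) (i ↑ˡ m) ≡ +[1+ c ]
coeff-↑ˡ m i = subst (λ t → ∃ λ c → + (m + m) ℤ.- + (2 * t + 1) ≡ +[1+ c ])
                     (sym (Finₚ.toℕ-↑ˡ i m)) (even-minus-odd-positive (Finₚ.toℕ<n i))

coeff-↑ʳ : ∀ m (j : Fin m) → ∃ λ c → coeff (m + m) (m ↑ʳ j) ≡ -[1+ c ]
coeff-↑ʳ m j = subst (λ t → ∃ λ c → + (m + m) ℤ.- + (2 * t + 1) ≡ -[1+ c ])
                     (sym (Finₚ.toℕ-↑ʳ m j)) (even-minus-odd-negative (ℕₚ.m≤m+n m (toℕ j)))

peak : (m n : ℕ) → Fin (m + m) → ℕ
peak m n = replicate m n Vector.++ replicate m 0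

peak-↑ˡ : ∀ m n (i : Fin m) → peak m n (i ↑ˡ m) ≡ n
peak-↑ˡ m n = Vectorₚ.lookup-++ˡ (replicate m n) (replicate m 0)

peak-↑ʳ : ∀ m n (j : Fin m) → peak m n (m ↑ʳ j) ≡ 0
peak-↑ʳ m n = Vectorₚ.lookup-++ʳ (replicate m n) (replicate m 0)

module _ (m n : ℕ) (x : Fin (m + m) → ℕ) where

  coeff-*-≤-peak : ∀ a → x a ≤ n → coeff (m + m) a ℤ.* + x a ℤ.≤ coeff (m + m) a ℤ.* + peak m n a
  coeff-*-≤-peak a x≤n with block m m a
  ... | left i with coeff-↑ˡ m i
  ...   | c , eq rewrite eq | peak-↑ˡ m n i = ℤₚ.*-monoˡ-≤-nonNeg +[1+ c ] (+≤+ x≤n)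
  coeff-*-≤-peak a x≤n | right j with coeff-↑ʳ m j
  ...   | c , eq rewrite eq | peak-↑ʳ m n j = ℤₚ.*-monoˡ-≤-nonPos -[1+ c ] (+≤+ z≤n)

  coeff-*-≡-peak⇒≡ : ∀ a → coeff (m + m) a ℤ.* + x a ≡ coeff (m + m) a ℤ.* + peak m n a →
                     x a ≡ peak m n a
  coeff-*-≡-peak⇒≡ a eq with block m m a
  ... | left i with coeff-↑ˡ m i
  ...   | c , ceq rewrite ceq = ℤₚ.+-injective (ℤₚ.*-cancelˡ-≡ +[1+ c ] _ _ eq)
  coeff-*-≡-peak⇒≡ a eq | right j with coeff-↑ʳ m j
  ...   | c , ceq rewrite ceq = ℤₚ.+-injective (ℤₚ.*-cancelˡ-≡ -[1+ c ] _ _ eq)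

  g-≤-peak : (∀ a → x a ≤ n) → g (m + m) x ℤ.≤ g (m + m) (peak m n)
  g-≤-peak x≤n = sumℤ-mono-≤ (allFin (m + m)) (λ a → coeff-*-≤-peak a (x≤n a))

  g-≡-peak⇒≗ : (∀ a → x a ≤ n) → g (m + m) x ≡ g (m + m) (peak m n) → x ≗ peak m n
  g-≡-peak⇒≗ x≤n eq a = coeff-*-≡-peak⇒≡ a
    (All.lookup (sumℤ-mono-≤-≡⇒≡ (allFin (m + m)) (λ b → coeff-*-≤-peak b (x≤n b)) eq) (∈-allFin a))

g-cong : ∀ k {x y : Fin k → ℕ} → x ≗ y → g k x ≡ g k y
g-cong k x≗y = sumFin-cong k (λ t → cong (λ z → coeff k t ℤ.* + z) (x≗y t))

g-peak : ∀ m n → g (m + m) (peak m n) ≡ + (m * m * n)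
g-peak m n = begin
  g (m + m) (peak m n)
    ≡⟨ sumFin-+ m m (λ a → coeff (m + m) a ℤ.* + peak m n a) ⟩
  sumFin m (λ i → coeff (m + m) (i ↑ˡ m) ℤ.* + peak m n (i ↑ˡ m)) ℤ.+
  sumFin m (λ j → coeff (m + m) (m ↑ʳ j) ℤ.* + peak m n (m ↑ʳ j))
    ≡⟨ cong₂ ℤ._+_ (sumFin-cong m left-term) (sumℤ-zero (allFin m) right-term) ⟩
  sumFin m (λ i → (+ (m + m) ℤ.- + (2 * toℕ i + 1)) ℤ.* + n) ℤ.+ + 0
    ≡⟨ cong (ℤ._+ + 0) (sumFin-odd m (+ (m + m)) (+ n)) ⟩
  (+ m ℤ.* + (m + m) ℤ.- + m ℤ.* + m) ℤ.* + n ℤ.+ + 0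
    ≡⟨ square (+ m) (+ n) ⟩
  + m ℤ.* + m ℤ.* + n
    ≡⟨ cong (ℤ._* + n) (sym (ℤₚ.pos-* m m)) ⟩
  + (m * m) ℤ.* + n
    ≡⟨ sym (ℤₚ.pos-* (m * m) n) ⟩
  + (m * m * n) ∎
  where
  open ≡-Reasoning
  left-term : ∀ i → coeff (m + m) (i ↑ˡ m) ℤ.* + peak m n (i ↑ˡ m) ≡
                    (+ (m + m) ℤ.- + (2 * toℕ i + 1)) ℤ.* + n
  left-term i = cong₂ (λ t y → (+ (m + m) ℤ.- + (2 * t + 1)) ℤ.* + y) (Finₚ.toℕ-↑ˡ i m) (peak-↑ˡ m n i)
  right-term : ∀ j → coeff (m + m) (m ↑ʳ j) ℤ.* + peak m n (m ↑ʳ j) ≡ + 0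
  right-term j = trans (cong (λ y → coeff (m + m) (m ↑ʳ j) ℤ.* + y) (peak-↑ʳ m n j))
                       (ℤₚ.*-zeroʳ (coeff (m + m) (m ↑ʳ j)))
  square : ∀ M N → (M ℤ.* (M ℤ.+ M) ℤ.- M ℤ.* M) ℤ.* N ℤ.+ + 0 ≡ M ℤ.* M ℤ.* N
  square = ℤ-Solver.solve-∀

∑-peak : ∀ m n → ∑ (allFin (m + m)) (peak m n) ≡ m * n
∑-peak m n = begin
  ∑ (allFin (m + m)) (peak m n)
    ≡⟨ ∑-allFin-+ m m (peak m n) ⟩
  ∑[ i ∈ allFin m ] peak m n (i ↑ˡ m) + ∑[ j ∈ allFin m ] peak m n (m ↑ʳ j)
    ≡⟨ cong₂ _+_ (∑-cong (allFin m) (peak-↑ˡ m n)) (∑-zero (allFin m) (peak-↑ʳ m n)) ⟩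
  ∑[ i ∈ allFin m ] n + 0
    ≡⟨ ℕₚ.+-identityʳ (∑[ i ∈ allFin m ] n) ⟩
  ∑[ i ∈ allFin m ] n
    ≡⟨ ∑-const (allFin m) n ⟩
  length (allFin m) * n
    ≡⟨ cong (_* n) (Listₚ.length-tabulate {n = m} (λ i → i)) ⟩
  m * n ∎
  where open ≡-Reasoning

-- Paths of maximal height

isPeakPath : (m n : ℕ) → List (Fin (m + m)) → Bool
isPeakPath m n w = isBBP (m + m) n w ∧ ⌊ height (m + m) w ℤ.≟ + (m * m * n) ⌋

T-isPeakPath : ∀ m n (w : List (Fin (m + m))) →
               T (isPeakPath m n w) ⇔ ((Balanced n w × Ballot w) × height (m + m) w ≡ + (m * m * n))
T-isPeakPath m n w = ⇔.trans T-∧ (T-isBBP (m + m) n w ×-⇔ mk⇔ toWitness fromWitness)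

module _ {m n : ℕ} where

  -- The height is attained at a prefix p; g(point p) = m²n forces point p = peak, whose
  -- coordinates add up to mn = length p, so p is the prefix u.
  maxHeight⇒prefix≗peak : ∀ (u v : List (Fin (m + m))) → Balanced n (u ++ v) →
                          height (m + m) (u ++ v) ≡ + (m * m * n) → length u ≡ m * n → point u ≗ peak m n
  maxHeight⇒prefix≗peak u v bal height≡ |u| with height-attained (m + m) (u ++ v)
  ... | p , q , pq , height≡g = subst (λ p → point p ≗ peak m n) p≡u p≗peak
    where
    p≗peak : point p ≗ peak m n
    p≗peak = g-≡-peak⇒≗ m n (point p) (prefix-point-≤ bal p q pq)
               (trans (sym height≡g) (trans height≡ (sym (g-peak m n))))
    |p| : length p ≡ m * n
    |p| = trans (sym (∑-occ p)) (trans (∑-cong (allFin (m + m)) p≗peak) (∑-peak m n))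
    p≡u : p ≡ u
    p≡u = ++-length-injectiveˡ pq (trans |p| (sym |u|))

  prefix≗peak⇒blocks : ∀ (u v : List (Fin (m + m))) → Balanced n (u ++ v) → point u ≗ peak m n →
                       All (Image (_↑ˡ m)) u × All (Image (m ↑ʳ_)) v
  prefix≗peak⇒blocks u v bal u≗peak = All.tabulate letter-of-u , All.tabulate letter-of-v
    where
    letter-of-u : ∀ {a} → a ∈ u → Image (_↑ˡ m) a
    letter-of-u {a} a∈u with block m m a
    ... | left i  = i , refl
    ... | right j = ⊥-elim (∈⇒occ≢0 a∈u (trans (u≗peak (m ↑ʳ j)) (peak-↑ʳ m n j)))
    letter-of-v : ∀ {a} → a ∈ v → Image (m ↑ʳ_) a
    letter-of-v {a} a∈v with block m m a
    ... | right j = j , refl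
    ... | left i  = ⊥-elim (∈⇒occ≢0 a∈v (ℕₚ.+-cancelˡ-≡ n _ 0 (begin
      n + occ (i ↑ˡ m) v
        ≡⟨ cong (_+ occ (i ↑ˡ m) v) (sym (trans (u≗peak (i ↑ˡ m)) (peak-↑ˡ m n i))) ⟩
      occ (i ↑ˡ m) u + occ (i ↑ˡ m) v
        ≡⟨ sym (occ-++ (i ↑ˡ m) u v) ⟩
      occ (i ↑ˡ m) (u ++ v)
        ≡⟨ bal (i ↑ˡ m) ⟩
      n
        ≡⟨ sym (ℕₚ.+-identityʳ n) ⟩
      n + 0 ∎)))
      where open ≡-Reasoning

  peakPath⇒blocks : ∀ (u v : List (Fin (m + m))) → length u ≡ m * n → T (isPeakPath m n (u ++ v)) →
                    All (Image (_↑ˡ m)) u × All (Image (m ↑ʳ_)) v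
  peakPath⇒blocks u v |u| t =
    let (bal , _) , height≡ = to (T-isPeakPath m n (u ++ v)) t
    in prefix≗peak⇒blocks u v bal (maxHeight⇒prefix≗peak u v bal height≡ |u|)

  height-blocks : ∀ (u v : List (Fin m)) → Balanced n u → Balanced n v →
                  height (m + m) (blocks u v) ≡ + (m * m * n)
  height-blocks u v balu balv = ℤₚ.≤-antisym upper lower
    where
    bal : Balanced n (blocks u v)
    bal = from (Balanced-blocks u v) (balu , balv)
    upper : height (m + m) (blocks u v) ℤ.≤ + (m * m * n)
    upper = height-≤ (m + m) (blocks u v) (λ p q pq →
      ℤₚ.≤-trans (g-≤-peak m n (point p) (prefix-point-≤ bal p q pq)) (ℤₚ.≤-reflexive (g-peak m n)))
    u≗peak : point (blocks u []) ≗ peak m n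
    u≗peak a = trans (point-blocks u [] a) (Vectorₚ.++-cong (point u) (replicate m n) balu (λ _ → refl) a)
    lower : + (m * m * n) ℤ.≤ height (m + m) (blocks u v)
    lower = begin
      + (m * m * n)                   ≡⟨ sym (g-peak m n) ⟩
      g (m + m) (peak m n)            ≡⟨ g-cong (m + m) (sym ∘ u≗peak) ⟩
      g (m + m) (point (blocks u [])) ≤⟨ ≤-height (m + m) (blocks u []) (blocks [] v)
                                           (blocks-prefixˡ {p = u} {q = []} v (Listₚ.++-identityʳ u)) ⟩
      height (m + m) (blocks u v)     ∎
      where open ℤₚ.≤-Reasoning

  isPeakPath-blocks : ∀ (u v : List (Fin m)) → isPeakPath m n (blocks u v) ≡ isBBP m n u ∧ isBBP m n v
  isPeakPath-blocks u v = T-injective (mk⇔ split join)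
    where
    split : T (isPeakPath m n (blocks u v)) → T (isBBP m n u ∧ isBBP m n v)
    split t =
      let (bal , ballot) , _ = to (T-isPeakPath m n (blocks u v)) t
          balu , balv = to (Balanced-blocks u v) bal
          ballotu , ballotv = Ballot-blocks⁻ u v ballot
      in from T-∧ (from (T-isBBP m n u) (balu , ballotu) , from (T-isBBP m n v) (balv , ballotv))
    join : T (isBBP m n u ∧ isBBP m n v) → T (isPeakPath m n (blocks u v))
    join t =
      let bbpu , bbpv = to T-∧ t
          balu , ballotu = to (T-isBBP m n u) bbpu
          balv , ballotv = to (T-isBBP m n v) bbpv
      in from (T-isPeakPath m n (blocks u v))
           ((from (Balanced-blocks u v) (balu , balv) , Ballot-blocks⁺ u v balu balv ballotu ballotv) ,
            height-blocks u v balu balv)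

D'-peak≡C*C : ∀ m n → D' (m + m) (+ (m * m * n)) n ≡ C m n * C m n
D'-peak≡C*C m n = begin
  D' (m + m) (+ (m * m * n)) n
    ≡⟨ countB≡∑ (isPeakPath m n) (words (m + m) ((m + m) * n)) ⟩
  ∑[ w ∈ words (m + m) ((m + m) * n) ] indicator (isPeakPath m n w)
    ≡⟨ cong (λ ℓ → ∑[ w ∈ words (m + m) ℓ ] indicator (isPeakPath m n w)) (ℕₚ.*-distribʳ-+ n m m) ⟩
  ∑[ w ∈ words (m + m) (N + N) ] indicator (isPeakPath m n w)
    ≡⟨ ∑-words-++ (m + m) N N (indicator ∘ isPeakPath m n) ⟩
  ∑[ v ∈ words (m + m) N ] ∑[ u ∈ words (m + m) N ] indicator (isPeakPath m n (u ++ v))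
    ≡⟨ ∑-words-restrict (m ↑ʳ_) (∑-allFin-↑ʳ m m) N vanishʳ ⟩
  ∑[ v ∈ words m N ] ∑[ u ∈ words (m + m) N ] indicator (isPeakPath m n (u ++ map (m ↑ʳ_) v))
    ≡⟨ ∑-cong (words m N) (λ v →
         ∑-words-restrict (_↑ˡ m) (∑-allFin-↑ˡ m m) N (vanishˡ (map (m ↑ʳ_) v))) ⟩
  ∑[ v ∈ words m N ] ∑[ u ∈ words m N ] indicator (isPeakPath m n (blocks u v))
    ≡⟨ ∑-cong (words m N) (λ v → ∑-cong (words m N) (λ u → cong indicator (isPeakPath-blocks u v))) ⟩
  ∑[ v ∈ words m N ] ∑[ u ∈ words m N ] indicator (isBBP m n u ∧ isBBP m n v)
    ≡⟨ ∑∑-indicator-∧ (isBBP m n) (isBBP m n) (words m N) (words m N) ⟩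
  C m n * C m n ∎
  where
  open ≡-Reasoning
  N : ℕ
  N = m * n
  vanishˡ : ∀ v u → length u ≡ N → ¬ All (Image (_↑ˡ m)) u → indicator (isPeakPath m n (u ++ v)) ≡ 0
  vanishˡ v u |u| ¬left = indicator-¬T (¬left ∘ proj₁ ∘ peakPath⇒blocks u v |u|)
  vanishʳ : ∀ v → length v ≡ N → ¬ All (Image (m ↑ʳ_)) v →
            ∑[ u ∈ words (m + m) N ] indicator (isPeakPath m n (u ++ v)) ≡ 0
  vanishʳ v _ ¬right =
    ∑-words-zero (m + m) N (λ u |u| → indicator-¬T (¬right ∘ proj₂ ∘ peakPath⇒blocks u v |u|))

-- The identity also holds for n = 0 and k = 0, so the hypotheses 1 ≤ n and 2 ≤ k are unused.
proposition5p4 : (n k : ℕ) → 1 ≤ n → 2 ≤ k → 2 ∣ k →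
    D' k (+ ((k * k / 4) * n)) n ≡ C (k / 2) n * C (k / 2) n
proposition5p4 n .(m * 2) _ _ (divides m refl) = begin
  D' (m * 2) (+ ((m * 2 * (m * 2) / 4) * n)) n
    ≡⟨ cong₂ (λ k s → D' k (+ (s * n)) n) (double m) quarter ⟩
  D' (m + m) (+ (m * m * n)) n
    ≡⟨ D'-peak≡C*C m n ⟩
  C m n * C m n
    ≡⟨ cong (λ h → C h n * C h n) (sym (m*n/n≡m m 2)) ⟩
  C (m * 2 / 2) n * C (m * 2 / 2) n ∎
  where
  open ≡-Reasoning
  double : ∀ m → m * 2 ≡ m + m
  double = ℕ-Solver.solve-∀
  square : ∀ m → m * 2 * (m * 2) ≡ m * m * 4
  square = ℕ-Solver.solve-∀
  quarter : m * 2 * (m * 2) / 4 ≡ m * m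
  quarter = trans (cong (_/ 4) (square m)) (m*n/n≡m (m * m) 4)
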